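{- Let $X,Y$ be complete lattices. For each $x \in X$, $y \in Y$ and $f \in \mathrm{Hom}_{\vee}(X,Y)$, the following conditions are equivalent: (i) for all $t \in X$, $t \leq x$ or $y \leq f(t)$; (ii) $e_{y,x} \leq f$; (iii) $y\,\underline{\otimes}\,x \leq f^{\wedge}$ in $\mathrm{Hom}_{\wedge}(X,Y)$; (iv) $y \leq f^{\wedge}(x)$; (v) $f^{*}(y) \leq x$; (vi) $f^{*} \leq x\,\overline{\otimes}\,y$ in $\mathrm{Hom}_{\vee}(Y,X)$.
   Context: For complete lattices $X,Y$: $\mathrm{Hom}_{\vee}(X,Y)$ (resp. $\mathrm{Hom}_{\wedge}(X,Y)$) is the set of maps $X\to Y$ preserving arbitrary joins (resp. meets), ordered pointwise. For $y\in Y$, $x\in X$: $e_{y,x}\in\mathrm{Hom}_{\vee}(X,Y)$ is $e_{y,x}(t) = y$ if $t\not\leq x$ and $\bot$ if $t\leq x$ (it is the composite $c_y\circ a_x$ of $a_x:X\to\{\bot,\top\}$, $a_x(t)=\top$ iff $t\not\le x$, and $c_y:\{\bot,\top\}\to Y$, $c_y(\top)=y$, $c_y(\bot)=\bot$); $y\,\underline{\otimes}\,x \in \mathrm{Hom}_{\wedge}(X,Y)$ is $(y\,\underline{\otimes}\,x)(t) = \top$ if $t=\top$, $=y$ if $x \leq t \neq \top$, $=\bot$ otherwise; for $x\in X$, $y \in Y$, $x\,\overline{\otimes}\,y \in \mathrm{Hom}_{\vee}(Y,X)$ is $(x\,\overline{\otimes}\,y)(s)=\top$ if $s\not\leq y$,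 $=x$ if $\bot < s \leq y$, $=\bot$ if $s=\bot$. For $f\in\mathrm{Hom}_{\vee}(X,Y)$, $f^{\wedge}(x) := \bigwedge_{t\in X,\ t\not\leq x} f(t)$ defines $f^\wedge\in\mathrm{Hom}_{\wedge}(X,Y)$, and $f^{*}:Y\to X$ denotes the left adjoint of $f^{\wedge}$. -}

module Defs where

open import Level using (Level; suc)
open import Data.Bool using (if_then_else_)
open import Data.Product using (Σ; proj₁; _×_)
open import Data.Empty.Polymorphic using (⊥)
open import Relation.Nullary using (¬_; does)
open import Relation.Binary.Core using (Rel)
open import Relation.Binary.Structures using (IsPartialOrder)
open import Relation.Binary.PropositionalEquality using (_≡_)
open import Axiom.ExcludedMiddle using (ExcludedMiddle)
open import Function.Bundles using (_⇔_)

record CompleteLattice (ℓ : Level) : Set (suc ℓ) where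
  field
    Carrier        : Set ℓ
    _≤_            : Rel Carrier ℓ
    isPartialOrder : IsPartialOrder _≡_ _≤_
    ⋁              : {I : Set ℓ} → (I → Carrier) → Carrier
    ⋁-upper        : {I : Set ℓ} (g : I → Carrier) (i : I) → g i ≤ ⋁ g
    ⋁-least        : {I : Set ℓ} (g : I → Carrier) (z : Carrier) → (∀ i → g i ≤ z) → ⋁ g ≤ z
    ⋀              : {I : Set ℓ} → (I → Carrier) → Carrier
    ⋀-lower        : {I : Set ℓ} (g : I → Carrier) (i : I) → ⋀ g ≤ g i
    ⋀-greatest     : {I : Set ℓ} (g : I → Carrier) (z : Carrier) → (∀ i → z ≤ g i) → z ≤ ⋀ g

  ⊥L : Carrier
  ⊥L = ⋁ {I = ⊥} (λ ())

  ⊤L : Carrier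
  ⊤L = ⋀ {I = ⊥} (λ ())

open CompleteLattice public

module _ {ℓ : Level} where

  PreservesJoins : (X Y : CompleteLattice ℓ) → (Carrier X → Carrier Y) → Set (suc ℓ)
  PreservesJoins X Y f = {I : Set ℓ} (g : I → Carrier X) → f (⋁ X g) ≡ ⋁ Y (λ i → f (g i))

  PointwiseLE : {X : Set ℓ} (Y : CompleteLattice ℓ) → (X → Carrier Y) → (X → Carrier Y) → Set ℓ
  PointwiseLE {X} Y f g = (t : X) → _≤_ Y (f t) (g t)

  e : ExcludedMiddle ℓ → (X Y : CompleteLattice ℓ) → Carrier Y → Carrier X → Carrier X → Carrier Y
  e lem X Y y x t = if does (lem {_≤_ X t x}) then ⊥L Y else y

  utensor : ExcludedMiddle ℓ → (X Y : CompleteLattice ℓ) → Carrier Y → Carrier X → Carrier X → Carrier Y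
  utensor lem X Y y x t =
    if does (lem {t ≡ ⊤L X}) then ⊤L Y
    else (if does (lem {_≤_ X x t}) then y else ⊥L Y)

  otensor : ExcludedMiddle ℓ → (X Y : CompleteLattice ℓ) → Carrier X → Carrier Y → Carrier Y → Carrier X
  otensor lem X Y x y s =
    if does (lem {_≤_ Y s y})
    then (if does (lem {s ≡ ⊥L Y}) then ⊥L X else x)
    else ⊤L X

  fwedge : (X Y : CompleteLattice ℓ) → (Carrier X → Carrier Y) → Carrier X → Carrier Y
  fwedge X Y f x = ⋀ Y {I = Σ (Carrier X) (λ t → ¬ (_≤_ X t x))} (λ p → f (proj₁ p))

  IsLeftAdjoint : (X Y : CompleteLattice ℓ) → (Carrier Y → Carrier X) → (Carrier X → Carrier Y) → Set ℓ
  IsLeftAdjoint X Y g h = (y : Carrier Y) (x : Carrier X) → (_≤_ X (g y) x) ⇔ (_≤_ Y y (h x))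

{-# OPTIONS --safe #-}
-- Every condition is compared with (iv), y ≤ f^∧(x). Conditions (i) and (ii) just
-- unfold the meet defining f^∧(x). A monotone g with g(⊤) = ⊤ satisfies
-- y ⊗̲ x ≤ g iff y ≤ g(x), which gives (iii); dually a monotone g with g(⊥) = ⊥
-- satisfies g ≤ x ⊗̄ y iff g(y) ≤ x, which gives (vi) since the left adjoint f* is
-- monotone and preserves ⊥. Condition (v) is the adjunction itself.
module Submission where

open import Defs
open import Level using (Level)
open import Data.Product using (_×_; _,_)
open import Data.Sum using (_⊎_; inj₁; inj₂)
open import Data.Empty using (⊥-elim)
open import Function.Bundles using (_⇔_; mk⇔; Equivalence)
open import Function.Properties.Equivalence using (sym; trans)
open import Axiom.ExcludedMiddle using (ExcludedMiddle)
open import Relation.Nullary using (yes; no; ¬_)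
open import Relation.Binary.Core using (_Preserves_⟶_)
open import Relation.Binary.PropositionalEquality using (_≡_; refl)
open import Relation.Binary.Structures using (IsPartialOrder)

private
  variable
    ℓ : Level

≤-refl : (L : CompleteLattice ℓ) {a : Carrier L} → _≤_ L a a
≤-refl L = IsPartialOrder.refl (isPartialOrder L)

≤-trans : (L : CompleteLattice ℓ) {a b c : Carrier L} →
  _≤_ L a b → _≤_ L b c → _≤_ L a c
≤-trans L = IsPartialOrder.trans (isPartialOrder L)

⊥L-least : (L : CompleteLattice ℓ) (a : Carrier L) → _≤_ L (⊥L L) a
⊥L-least L a = ⋁-least L (λ ()) a (λ ())

⊤L-greatest : (L : CompleteLattice ℓ) (a : Carrier L) → _≤_ L a (⊤L L)
⊤L-greatest L a = ⋀-greatest L (λ ()) a (λ ())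

∀¬⇒⇔∀⊎ : {A : Set ℓ} {P Q : A → Set ℓ} → ExcludedMiddle ℓ →
  ((a : A) → ¬ P a → Q a) ⇔ ((a : A) → P a ⊎ Q a)
∀¬⇒⇔∀⊎ {P = P} {Q} lem = mk⇔ (λ h a → to (h a)) (λ h a → from (h a))
  where
  to : ∀ {a} → (¬ P a → Q a) → P a ⊎ Q a
  to {a} h with lem {P a}
  ... | yes p = inj₁ p
  ... | no ¬p = inj₂ (h ¬p)
  from : ∀ {a} → P a ⊎ Q a → ¬ P a → Q a
  from (inj₁ p) ¬p = ⊥-elim (¬p p)
  from (inj₂ q) _  = q

module _ (X Y : CompleteLattice ℓ) (f : Carrier X → Carrier Y) where

  ≤-fwedge⇔ : (x : Carrier X) (y : Carrier Y) →
    _≤_ Y y (fwedge X Y f x) ⇔ ((t : Carrier X) → ¬ _≤_ X t x → _≤_ Y y (f t))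
  ≤-fwedge⇔ x y = mk⇔
    (λ h t t≰x → ≤-trans Y h (⋀-lower Y _ (t , t≰x)))
    (λ h → ⋀-greatest Y _ y (λ { (t , t≰x) → h t t≰x }))

  fwedge-mono : fwedge X Y f Preserves _≤_ X ⟶ _≤_ Y
  fwedge-mono {x} {x′} x≤x′ = ⋀-greatest Y _ _ λ { (t , t≰x′) →
    ⋀-lower Y _ (t , λ t≤x → t≰x′ (≤-trans X t≤x x≤x′)) }

  -- The meet defining f^∧(⊤) is over the empty family, whatever f is.
  fwedge-⊤ : _≤_ Y (⊤L Y) (fwedge X Y f (⊤L X))
  fwedge-⊤ = ⋀-greatest Y _ _ λ { (t , t≰⊤) → ⊥-elim (t≰⊤ (⊤L-greatest X t)) }

module _ (lem : ExcludedMiddle ℓ) (X Y : CompleteLattice ℓ) where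

  e-≤⇔ : (y : Carrier Y) (x : Carrier X) (f : Carrier X → Carrier Y) →
    PointwiseLE Y (e lem X Y y x) f ⇔ ((t : Carrier X) → ¬ _≤_ X t x → _≤_ Y y (f t))
  e-≤⇔ y x f = mk⇔ to from
    where
    to : PointwiseLE Y (e lem X Y y x) f → (t : Carrier X) → ¬ _≤_ X t x → _≤_ Y y (f t)
    to h t t≰x with lem {_≤_ X t x} | h t
    ... | yes t≤x | _ = ⊥-elim (t≰x t≤x)
    ... | no _    | q = q
    from : ((t : Carrier X) → ¬ _≤_ X t x → _≤_ Y y (f t)) → PointwiseLE Y (e lem X Y y x) f
    from h t with lem {_≤_ X t x}
    ... | yes _   = ⊥L-least Y (f t)
    ... | no t≰x  = h t t≰x

  utensor-≤⇔ : (y : Carrier Y) (x : Carrier X) (g : Carrier X → Carrier Y) →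
    g Preserves _≤_ X ⟶ _≤_ Y → _≤_ Y (⊤L Y) (g (⊤L X)) →
    PointwiseLE Y (utensor lem X Y y x) g ⇔ _≤_ Y y (g x)
  utensor-≤⇔ y x g g-mono g-⊤ = mk⇔ to from
    where
    to : PointwiseLE Y (utensor lem X Y y x) g → _≤_ Y y (g x)
    to h with lem {x ≡ ⊤L X} | h x
    ... | yes refl | _ = ≤-trans Y (⊤L-greatest Y y) g-⊤
    ... | no _     | q with lem {_≤_ X x x}
    ...   | yes _  = q
    ...   | no x≰x = ⊥-elim (x≰x (≤-refl X))
    from : _≤_ Y y (g x) → PointwiseLE Y (utensor lem X Y y x) g
    from h t with lem {t ≡ ⊤L X}
    ... | yes refl = g-⊤
    ... | no _ with lem {_≤_ X x t}
    ...   | yes x≤t = ≤-trans Y h (g-mono x≤t)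
    ...   | no _    = ⊥L-least Y (g t)

  otensor-≤⇔ : (x : Carrier X) (y : Carrier Y) (g : Carrier Y → Carrier X) →
    g Preserves _≤_ Y ⟶ _≤_ X → _≤_ X (g (⊥L Y)) (⊥L X) →
    PointwiseLE X g (otensor lem X Y x y) ⇔ _≤_ X (g y) x
  otensor-≤⇔ x y g g-mono g-⊥ = mk⇔ to from
    where
    to : PointwiseLE X g (otensor lem X Y x y) → _≤_ X (g y) x
    to h with lem {_≤_ Y y y} | h y
    ... | no y≰y | _ = ⊥-elim (y≰y (≤-refl Y))
    ... | yes _  | q with lem {y ≡ ⊥L Y}
    ...   | yes _ = ≤-trans X q (⊥L-least X x)
    ...   | no _  = q
    from : _≤_ X (g y) x → PointwiseLE X g (otensor lem X Y x y)
    from h s with lem {_≤_ Y s y}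
    ... | no _ = ⊤L-greatest X (g s)
    ... | yes s≤y with lem {s ≡ ⊥L Y}
    ...   | yes refl = g-⊥
    ...   | no _     = ≤-trans X (g-mono s≤y) h

module _ (X Y : CompleteLattice ℓ) {g : Carrier Y → Carrier X} {h : Carrier X → Carrier Y}
  (adj : IsLeftAdjoint X Y g h) where

  leftAdjoint-mono : g Preserves _≤_ Y ⟶ _≤_ X
  leftAdjoint-mono {a} {b} a≤b = Equivalence.from (adj a (g b))
    (≤-trans Y a≤b (Equivalence.to (adj b (g b)) (≤-refl X)))

  leftAdjoint-⊥ : _≤_ X (g (⊥L Y)) (⊥L X)
  leftAdjoint-⊥ = Equivalence.from (adj (⊥L Y) (⊥L X)) (⊥L-least Y _)

mainTheorem4 : {ℓ : Level} (lem : ExcludedMiddle ℓ) (X Y : CompleteLattice ℓ)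
    (f : Carrier X → Carrier Y) → PreservesJoins X Y f →
    (fstar : Carrier Y → Carrier X) → IsLeftAdjoint X Y fstar (fwedge X Y f) →
    (x : Carrier X) (y : Carrier Y) →
    (((t : Carrier X) → _≤_ X t x ⊎ _≤_ Y y (f t)) ⇔ (PointwiseLE Y (e lem X Y y x) (f)))
    × ((PointwiseLE Y (e lem X Y y x) (f)) ⇔ (PointwiseLE Y (utensor lem X Y y x) (fwedge X Y f)))
    × ((PointwiseLE Y (utensor lem X Y y x) (fwedge X Y f)) ⇔ _≤_ Y y (fwedge X Y f x))
    × (_≤_ Y y (fwedge X Y f x) ⇔ _≤_ X (fstar y) x)
    × (_≤_ X (fstar y) x ⇔ (PointwiseLE X (fstar) (otensor lem X Y x y)))
mainTheorem4 lem X Y f _ fstar adj x y =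
    trans i⇔iv (sym ii⇔iv)
  , trans ii⇔iv (sym iii⇔iv)
  , iii⇔iv
  , sym (adj y x)
  , sym (otensor-≤⇔ lem X Y x y fstar (leftAdjoint-mono X Y adj) (leftAdjoint-⊥ X Y adj))
  where
  i⇔iv : ((t : Carrier X) → _≤_ X t x ⊎ _≤_ Y y (f t)) ⇔ _≤_ Y y (fwedge X Y f x)
  i⇔iv = sym (trans (≤-fwedge⇔ X Y f x y) (∀¬⇒⇔∀⊎ lem))
  ii⇔iv : PointwiseLE Y (e lem X Y y x) f ⇔ _≤_ Y y (fwedge X Y f x)
  ii⇔iv = trans (e-≤⇔ lem X Y y x f) (sym (≤-fwedge⇔ X Y f x y))
  iii⇔iv : PointwiseLE Y (utensor lem X Y y x) (fwedge X Y f) ⇔ _≤_ Y y (fwedge X Y f x)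
  iii⇔iv = utensor-≤⇔ lem X Y y x (fwedge X Y f) (fwedge-mono X Y f) (fwedge-⊤ X Y f)
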